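{- Let $G$ be a finite semisimple group. A non-Abelian simple subgroup $S \leq G$ is a direct factor of $\mathrm{Soc}(G)$ if and only if its normal closure $N = \mathrm{ncl}_G(S)$ is isomorphic to $S^k$ for some $k \geq 1$ and $S \trianglelefteq N$.
   Context: A finite group is semisimple if it has no nontrivial Abelian normal subgroups. $\mathrm{Soc}(G)$ is the subgroup generated by the minimal normal subgroups of $G$. $\mathrm{ncl}_G(S)$ is the smallest normal subgroup of $G$ containing $S$. -}

module Defs where

open import Level using (0ℓ)
open import Data.Nat using (ℕ; _≤_)
open import Data.Fin using (Fin)
open import Data.Fin.Subset using (Subset; _∈_; _⊆_)
open import Data.Product using (Σ; ∃; ∃-syntax; _×_; _,_)
open import Data.Sum using (_⊎_)
open import Relation.Nullary using (¬_)
open import Relation.Binary.PropositionalEquality using (_≡_)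
open import Algebra.Core using (Op₁; Op₂)
open import Algebra.Structures using (IsGroup)

record FinGroup : Set where
  infixl 7 _∙_
  field
    n      : ℕ
    _∙_    : Op₂ (Fin n)
    ε      : Fin n
    _⁻¹    : Op₁ (Fin n)
    isGroup : IsGroup _≡_ _∙_ ε _⁻¹

module _ (G : FinGroup) where
  open FinGroup G

  conj : Fin n → Fin n → Fin n
  conj g x = (g ∙ x) ∙ (g ⁻¹)

  IsSubgroup : Subset n → Set
  IsSubgroup H = (ε ∈ H)
               × (∀ {x y} → x ∈ H → y ∈ H → (x ∙ y) ∈ H)
               × (∀ {x} → x ∈ H → (x ⁻¹) ∈ H)

  NormalisedBy : Subset n → Subset n → Set
  NormalisedBy H K = ∀ {g x} → g ∈ K → x ∈ H → conj g x ∈ H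

  IsNormalSubgroup : Subset n → Set
  IsNormalSubgroup H = IsSubgroup H × (∀ g {x} → x ∈ H → conj g x ∈ H)

  IsTrivial : Subset n → Set
  IsTrivial H = ∀ {x} → x ∈ H → x ≡ ε

  IsAbelianSet : Subset n → Set
  IsAbelianSet H = ∀ {x y} → x ∈ H → y ∈ H → x ∙ y ≡ y ∙ x

  Semisimple : Set
  Semisimple = ∀ (A : Subset n) → IsNormalSubgroup A → IsAbelianSet A → IsTrivial A

  IsSimpleSubgroup : Subset n → Set
  IsSimpleSubgroup S =
    IsSubgroup S × ¬ IsTrivial S
    × (∀ (K : Subset n) → IsSubgroup K → K ⊆ S → NormalisedBy K S
         → IsTrivial K ⊎ S ⊆ K)

  IsMinimalNormal : Subset n → Set
  IsMinimalNormal M =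
    IsNormalSubgroup M × ¬ IsTrivial M
    × (∀ (K : Subset n) → IsNormalSubgroup K → K ⊆ M → IsTrivial K ⊎ M ⊆ K)

  data Gen (P : Fin n → Set) : Fin n → Set where
    gen-base : ∀ {x} → P x → Gen P x
    gen-ε    : Gen P ε
    gen-∙    : ∀ {x y} → Gen P x → Gen P y → Gen P (x ∙ y)
    gen-⁻¹   : ∀ {x} → Gen P x → Gen P (x ⁻¹)

  InSoc : Fin n → Set
  InSoc = Gen (λ x → ∃[ M ] (IsMinimalNormal M × x ∈ M))

  InNcl : Subset n → Fin n → Set
  InNcl S = Gen (λ x → ∃[ g ] ∃[ s ] (s ∈ S × x ≡ conj g s))

  -- S is a direct factor of Soc(G): S ⊆ Soc(G) and there is a subgroup T ⊆ Soc(G)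
  -- with S, T normal in Soc(G), S ∩ T = 1 and Soc(G) = S T.
  IsDirectFactorOfSoc : Subset n → Set
  IsDirectFactorOfSoc S = ∃[ T ]
    ( IsSubgroup T
    × (∀ {x} → x ∈ S → InSoc x)
    × (∀ {x} → x ∈ T → InSoc x)
    × (∀ {g x} → InSoc g → x ∈ S → conj g x ∈ S)
    × (∀ {g x} → InSoc g → x ∈ T → conj g x ∈ T)
    × (∀ {x} → x ∈ S → x ∈ T → x ≡ ε)
    × (∀ {x} → InSoc x → ∃[ s ] ∃[ t ] (s ∈ S × t ∈ T × x ≡ s ∙ t)))

  InPow : (k : ℕ) → Subset n → (Fin k → Fin n) → Set
  InPow k S a = ∀ i → a i ∈ S

  -- the subgroup (given by membership predicate N) is isomorphic to S^k
  -- (direct product of k copies of S, componentwise multiplication):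
  -- there is a bijective homomorphism φ : S^k → N.
  IsoToPow : (N : Fin n → Set) → Subset n → ℕ → Set
  IsoToPow N S k = Σ ((Fin k → Fin n) → Fin n) λ φ →
      (∀ a → InPow k S a → N (φ a))
    × (∀ a b → InPow k S a → InPow k S b → φ (λ i → a i ∙ b i) ≡ φ a ∙ φ b)
    × (∀ a b → InPow k S a → InPow k S b → φ a ≡ φ b → ∀ i → a i ≡ b i)
    × (∀ x → N x → ∃[ a ] (InPow k S a × φ a ≡ x))

{-# OPTIONS --safe #-}
-- If S is simple and normal in N = ncl(S), any two G-conjugates of S are simple
-- subgroups normalising each other, so they either coincide or meet trivially and
-- then commute elementwise. Multiplying one element from each distinct conjugate
-- is therefore a homomorphism S^k → N, onto because the conjugates generate N and
-- injective because S has trivial centre.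
-- Semisimplicity makes N minimal normal: a normal K ⊆ N either meets S, and then
-- contains S and hence N, or centralises S and hence N ⊇ K, so K is abelian.
-- The socle is then S × C_Soc(S), since a minimal normal subgroup either lies in
-- N, whose generators lie in S or centralise it, or meets N trivially and so
-- centralises it. Conversely, a direct factor S of the socle is normalised by
-- Soc ⊇ N.
module Submission where

open import Defs
open import Level using (0ℓ)
open import Data.Nat using (ℕ; zero; suc; _≤_; z≤n; s≤s)
import Data.Nat.Properties as ℕ
open import Data.Fin using (Fin)
import Data.Fin as Fin
open import Data.Fin.Properties using (any?; all?) renaming (_≟_ to _≟ᶠ_)
open import Data.Fin.Subset using (Subset; _∈_; _⊆_; _∩_; ⊥; ∣_∣)
open import Data.Fin.Subset.Properties
  using (_∈?_; _⊆?_; anySubset?; ∉⊥; ⊆-antisym; ∩-comm; x∈p∩q⁺; x∈p∩q⁻; p∩q⊆p; p∩q⊆q; p⊂q⇒∣p∣<∣q∣; ∣p∣≤n)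
open import Data.Vec using (tabulate)
open import Data.Vec.Properties using (lookup∘tabulate; lookup⇒[]=; []=⇒lookup; ≡-dec)
import Data.Vec.Functional as Vector
open import Data.Vec.Functional using (head; tail)
import Data.Bool.Properties as Bool
open import Data.List using (List; []; _∷_; length; allFin; deduplicate)
open import Data.List.Relation.Unary.All using (All; []; _∷_)
open import Data.List.Relation.Unary.Any using (Any; here; there)
import Data.List.Relation.Unary.Any as Any
open import Data.List.Relation.Unary.Any.Properties using (deduplicate⁺)
open import Data.List.Relation.Unary.AllPairs using (AllPairs; []; _∷_)
import Data.List.Relation.Unary.AllPairs as AllPairs
open import Data.List.Relation.Unary.Unique.DecSetoid.Properties using (deduplicate-!)
open import Data.List.Membership.Propositional.Properties using (∈-allFin)
open import Data.Product using (∃; ∃₂; ∃-syntax; _×_; _,_; proj₁; proj₂)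
open import Data.Sum using (_⊎_; inj₁; inj₂; [_,_]′; fromInj₁)
import Data.Sum as Sum
open import Data.Empty using (⊥-elim)
open import Function using (_∘_)
open import Function.Bundles using (_⇔_; mk⇔)
open import Relation.Nullary using (¬_; Dec; yes; no; does; contradiction)
open import Relation.Nullary.Decidable using (dec-true; dec-false; decidable-stable; map′; _×-dec_; _⊎-dec_; _→-dec_; ¬?)
open import Relation.Unary using (Pred; Decidable)
open import Relation.Binary.PropositionalEquality using (_≡_; _≢_; refl; sym; trans; cong; cong₂; subst; module ≡-Reasoning)
open import Relation.Binary.PropositionalEquality.Properties using (decSetoid)
import Relation.Binary.Construct.On as On
open import Algebra.Bundles using (Group)
open import Algebra.Structures using (IsGroup)
import Algebra.Properties.Group as GroupProperties

module _ {n : ℕ} where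

  subsetOf : {P : Pred (Fin n) 0ℓ} → Decidable P → Subset n
  subsetOf P? = tabulate (does ∘ P?)

  module _ {P : Pred (Fin n) 0ℓ} (P? : Decidable P) {x : Fin n} where

    ∈-subsetOf⁺ : P x → x ∈ subsetOf P?
    ∈-subsetOf⁺ p = lookup⇒[]= x _ (trans (lookup∘tabulate _ x) (dec-true (P? x) p))

    ∈-subsetOf⁻ : x ∈ subsetOf P? → P x
    ∈-subsetOf⁻ x∈ = decidable-stable (P? x) λ ¬p →
      contradiction (trans (sym (dec-false (P? x) ¬p)) (trans (sym (lookup∘tabulate _ x)) ([]=⇒lookup x∈))) λ ()

  allᵢ? : {P : Pred (Fin n) 0ℓ} → Decidable P → Dec (∀ {x} → P x)
  allᵢ? P? = map′ (λ p {x} → p x) (λ p x → p) (all? P?)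

  allSubsets? : {Q : Pred (Subset n) 0ℓ} → Decidable Q → Dec (∀ K → Q K)
  allSubsets? Q? with anySubset? (¬? ∘ Q?)
  ... | yes (K , ¬q) = no λ q → ¬q (q K)
  ... | no ¬∃ = yes λ K → decidable-stable (Q? K) λ ¬q → ¬∃ (K , ¬q)

module _ (G : FinGroup) where
  open FinGroup G
  open IsGroup isGroup using (assoc; identityˡ; identityʳ; inverseˡ; inverseʳ)

  private
    group : Group 0ℓ 0ℓ
    group = record { Carrier = Fin n ; _≈_ = _≡_ ; _∙_ = _∙_ ; ε = ε ; _⁻¹ = _⁻¹ ; isGroup = isGroup }

  open GroupProperties group
    using (ε⁻¹≈ε; ⁻¹-anti-homo-∙; inverseʳ-unique; x∙y⁻¹≈ε⇒x≈y; ∙-cancelˡ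
          ; \\-leftDividesˡ; \\-leftDividesʳ; //-rightDividesˡ; //-rightDividesʳ)
  open ≡-Reasoning

  conj-ε : ∀ g → conj G g ε ≡ ε
  conj-ε g = trans (cong (_∙ g ⁻¹) (identityʳ g)) (inverseʳ g)

  conj-∙ : ∀ g x y → conj G g (x ∙ y) ≡ conj G g x ∙ conj G g y
  conj-∙ g x y = sym (begin
    (g ∙ x ∙ g ⁻¹) ∙ (g ∙ y ∙ g ⁻¹)  ≡⟨ assoc (g ∙ x) (g ⁻¹) (g ∙ y ∙ g ⁻¹) ⟩
    g ∙ x ∙ (g ⁻¹ ∙ (g ∙ y ∙ g ⁻¹))  ≡⟨ cong (g ∙ x ∙_) (sym (assoc (g ⁻¹) (g ∙ y) (g ⁻¹))) ⟩
    g ∙ x ∙ (g ⁻¹ ∙ (g ∙ y) ∙ g ⁻¹)  ≡⟨ cong (λ z → g ∙ x ∙ (z ∙ g ⁻¹)) (\\-leftDividesʳ g y) ⟩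
    g ∙ x ∙ (y ∙ g ⁻¹)               ≡⟨ sym (assoc (g ∙ x) y (g ⁻¹)) ⟩
    g ∙ x ∙ y ∙ g ⁻¹                 ≡⟨ cong (_∙ g ⁻¹) (assoc g x y) ⟩
    g ∙ (x ∙ y) ∙ g ⁻¹               ∎)

  conj-⁻¹ : ∀ g x → conj G g (x ⁻¹) ≡ conj G g x ⁻¹
  conj-⁻¹ g x = inverseʳ-unique (conj G g x) (conj G g (x ⁻¹)) (begin
    conj G g x ∙ conj G g (x ⁻¹)  ≡⟨ sym (conj-∙ g x (x ⁻¹)) ⟩
    conj G g (x ∙ x ⁻¹)           ≡⟨ cong (conj G g) (inverseʳ x) ⟩
    conj G g ε                    ≡⟨ conj-ε g ⟩
    ε                             ∎)

  conj-conj : ∀ g h x → conj G g (conj G h x) ≡ conj G (g ∙ h) x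
  conj-conj g h x = begin
    g ∙ (h ∙ x ∙ h ⁻¹) ∙ g ⁻¹    ≡⟨ cong (_∙ g ⁻¹) (sym (assoc g (h ∙ x) (h ⁻¹))) ⟩
    g ∙ (h ∙ x) ∙ h ⁻¹ ∙ g ⁻¹    ≡⟨ assoc (g ∙ (h ∙ x)) (h ⁻¹) (g ⁻¹) ⟩
    g ∙ (h ∙ x) ∙ (h ⁻¹ ∙ g ⁻¹)  ≡⟨ cong₂ _∙_ (sym (assoc g h x)) (sym (⁻¹-anti-homo-∙ g h)) ⟩
    g ∙ h ∙ x ∙ (g ∙ h) ⁻¹       ∎

  conj-identity : ∀ x → conj G ε x ≡ x
  conj-identity x = trans (cong₂ _∙_ (identityˡ x) ε⁻¹≈ε) (identityʳ x)

  conj-inverseˡ : ∀ g x → conj G (g ⁻¹) (conj G g x) ≡ x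
  conj-inverseˡ g x = trans (conj-conj (g ⁻¹) g x) (trans (cong (λ h → conj G h x) (inverseˡ g)) (conj-identity x))

  conj-inverseʳ : ∀ g x → conj G g (conj G (g ⁻¹) x) ≡ x
  conj-inverseʳ g x = trans (conj-conj g (g ⁻¹) x) (trans (cong (λ h → conj G h x) (inverseʳ g)) (conj-identity x))

  conj-injective : ∀ g {x y} → conj G g x ≡ conj G g y → x ≡ y
  conj-injective g {x} {y} e = trans (sym (conj-inverseˡ g x)) (trans (cong (conj G (g ⁻¹)) e) (conj-inverseˡ g y))

  conj-distrib-conj : ∀ g h x → conj G g (conj G h x) ≡ conj G (conj G g h) (conj G g x)
  conj-distrib-conj g h x = trans (conj-∙ g (h ∙ x) (h ⁻¹)) (cong₂ _∙_ (conj-∙ g h x) (conj-⁻¹ g h))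

  Commute : Fin n → Fin n → Set
  Commute x y = x ∙ y ≡ y ∙ x

  commute-εˡ : ∀ y → Commute ε y
  commute-εˡ y = trans (identityˡ y) (sym (identityʳ y))

  commute-∙ˡ : ∀ {x z y} → Commute x y → Commute z y → Commute (x ∙ z) y
  commute-∙ˡ {x} {z} {y} xy zy = begin
    x ∙ z ∙ y    ≡⟨ assoc x z y ⟩
    x ∙ (z ∙ y)  ≡⟨ cong (x ∙_) zy ⟩
    x ∙ (y ∙ z)  ≡⟨ sym (assoc x y z) ⟩
    x ∙ y ∙ z    ≡⟨ cong (_∙ z) xy ⟩
    y ∙ x ∙ z    ≡⟨ assoc y x z ⟩
    y ∙ (x ∙ z)  ∎

  commute-⁻¹ˡ : ∀ {x y} → Commute x y → Commute (x ⁻¹) y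
  commute-⁻¹ˡ {x} {y} xy = begin
    x ⁻¹ ∙ y                 ≡⟨ sym (//-rightDividesʳ x (x ⁻¹ ∙ y)) ⟩
    x ⁻¹ ∙ y ∙ x ∙ x ⁻¹      ≡⟨ cong (_∙ x ⁻¹) (assoc (x ⁻¹) y x) ⟩
    x ⁻¹ ∙ (y ∙ x) ∙ x ⁻¹    ≡⟨ cong (λ z → x ⁻¹ ∙ z ∙ x ⁻¹) (sym xy) ⟩
    x ⁻¹ ∙ (x ∙ y) ∙ x ⁻¹    ≡⟨ cong (_∙ x ⁻¹) (\\-leftDividesʳ x y) ⟩
    y ∙ x ⁻¹                 ∎

  commute⇒conj≡ : ∀ {x y} → Commute x y → conj G x y ≡ y
  commute⇒conj≡ {x} {y} xy = trans (cong (_∙ x ⁻¹) xy) (//-rightDividesʳ x y)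

  conj≡⇒commute : ∀ {x y} → conj G x y ≡ y → Commute x y
  conj≡⇒commute {x} {y} e = trans (sym (//-rightDividesˡ x (x ∙ y))) (cong (_∙ x) e)

  commute-conj : ∀ g {x y} → Commute x y → Commute (conj G g x) (conj G g y)
  commute-conj g {x} {y} xy = trans (sym (conj-∙ g x y)) (trans (cong (conj G g) xy) (conj-∙ g y x))

  commutator-assoc : ∀ x y → conj G x y ∙ y ⁻¹ ≡ x ∙ conj G y (x ⁻¹)
  commutator-assoc x y = trans (assoc _ _ _) (trans (assoc _ _ _) (cong (x ∙_) (sym (assoc _ _ _))))

  commutator≡ε⇒commute : ∀ {x y} → conj G x y ∙ y ⁻¹ ≡ ε → Commute x y
  commutator≡ε⇒commute e = conj≡⇒commute (x∙y⁻¹≈ε⇒x≈y _ _ e)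

  commute⇒interchange : ∀ p q r s → Commute q r → (p ∙ q) ∙ (r ∙ s) ≡ (p ∙ r) ∙ (q ∙ s)
  commute⇒interchange p q r s qr = begin
    p ∙ q ∙ (r ∙ s)    ≡⟨ assoc p q (r ∙ s) ⟩
    p ∙ (q ∙ (r ∙ s))  ≡⟨ cong (p ∙_) (sym (assoc q r s)) ⟩
    p ∙ (q ∙ r ∙ s)    ≡⟨ cong (λ z → p ∙ (z ∙ s)) qr ⟩
    p ∙ (r ∙ q ∙ s)    ≡⟨ cong (p ∙_) (assoc r q s) ⟩
    p ∙ (r ∙ (q ∙ s))  ≡⟨ sym (assoc p r (q ∙ s)) ⟩
    p ∙ r ∙ (q ∙ s)    ∎

  -- IsSubgroup G A is definitionally SubgroupClosed (_∈ A), and IsNormalSubgroup G A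
  -- the pair of SubgroupClosed (_∈ A) and ConjClosed (_∈ A).
  SubgroupClosed : Pred (Fin n) 0ℓ → Set
  SubgroupClosed P = P ε × (∀ {x y} → P x → P y → P (x ∙ y)) × (∀ {x} → P x → P (x ⁻¹))

  ConjClosed : Pred (Fin n) 0ℓ → Set
  ConjClosed P = ∀ g {x} → P x → P (conj G g x)

  subgroupClosed-conj : ∀ {P} → SubgroupClosed P → ∀ {g x} → P g → P x → P (conj G g x)
  subgroupClosed-conj (_ , P-∙ , P-⁻¹) Pg Px = P-∙ (P-∙ Pg Px) (P-⁻¹ Pg)

  subgroupClosed-⇔ : ∀ {P Q} → (∀ {x} → P x → Q x) → (∀ {x} → Q x → P x) → SubgroupClosed P → SubgroupClosed Q
  subgroupClosed-⇔ P⇒Q Q⇒P (P-ε , P-∙ , P-⁻¹) =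
    P⇒Q P-ε , (λ Qx Qy → P⇒Q (P-∙ (Q⇒P Qx) (Q⇒P Qy))) , (λ Qx → P⇒Q (P-⁻¹ (Q⇒P Qx)))

  ×-subgroupClosed : ∀ {P Q} → SubgroupClosed P → SubgroupClosed Q → SubgroupClosed (λ x → P x × Q x)
  ×-subgroupClosed (P-ε , P-∙ , P-⁻¹) (Q-ε , Q-∙ , Q-⁻¹) =
    (P-ε , Q-ε) , (λ (Px , Qx) (Py , Qy) → P-∙ Px Py , Q-∙ Qx Qy) , (λ (Px , Qx) → P-⁻¹ Px , Q-⁻¹ Qx)

  subsetOf-isSubgroup : ∀ {P} (P? : Decidable P) → SubgroupClosed P → IsSubgroup G (subsetOf P?)
  subsetOf-isSubgroup P? = subgroupClosed-⇔ (∈-subsetOf⁺ P?) (∈-subsetOf⁻ P?)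

  ∩-isSubgroup : ∀ {A B} → IsSubgroup G A → IsSubgroup G B → IsSubgroup G (A ∩ B)
  ∩-isSubgroup {A} {B} A-sg B-sg = subgroupClosed-⇔ x∈p∩q⁺ (x∈p∩q⁻ A B) (×-subgroupClosed A-sg B-sg)

  ∩-isNormalSubgroup : ∀ {A B} → IsNormalSubgroup G A → IsNormalSubgroup G B → IsNormalSubgroup G (A ∩ B)
  ∩-isNormalSubgroup {A} {B} (A-sg , A-conj) (B-sg , B-conj) =
    ∩-isSubgroup A-sg B-sg , λ g x∈ → x∈p∩q⁺ (A-conj g (p∩q⊆p A B x∈) , B-conj g (p∩q⊆q A B x∈))

  conj-preimage-closed : ∀ {P} g → SubgroupClosed P → SubgroupClosed (P ∘ conj G g)
  conj-preimage-closed {P} g (P-ε , P-∙ , P-⁻¹) =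
    subst P (sym (conj-ε g)) P-ε ,
    (λ Px Py → subst P (sym (conj-∙ g _ _)) (P-∙ Px Py)) ,
    (λ Px → subst P (sym (conj-⁻¹ g _)) (P-⁻¹ Px))

  Gen-closed : ∀ {P} → SubgroupClosed (Gen G P)
  Gen-closed = gen-ε , gen-∙ , gen-⁻¹

  Gen-least : ∀ {P Q} → SubgroupClosed Q → (∀ {x} → P x → Q x) → ∀ {x} → Gen G P x → Q x
  Gen-least _ P⊆Q (gen-base p) = P⊆Q p
  Gen-least (Q-ε , _ , _) _ gen-ε = Q-ε
  Gen-least Q-sg@(_ , Q-∙ , _) P⊆Q (gen-∙ x y) = Q-∙ (Gen-least Q-sg P⊆Q x) (Gen-least Q-sg P⊆Q y)
  Gen-least Q-sg@(_ , _ , Q-⁻¹) P⊆Q (gen-⁻¹ x) = Q-⁻¹ (Gen-least Q-sg P⊆Q x)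

  Gen-conjClosed : ∀ {P} → ConjClosed P → ConjClosed (Gen G P)
  Gen-conjClosed P-conj g = Gen-least (conj-preimage-closed g Gen-closed) (λ p → gen-base (P-conj g p))

  -- ncl(S) and C_Soc(S) can only be formed as Subsets once membership in a
  -- generated subgroup is decided. This is done by saturation: approx m holds the
  -- elements reached in fewer than m closure steps, and it stabilises by size.
  module _ {P : Pred (Fin n) 0ℓ} (P? : Decidable P) where
    private
      Step : Subset n → Pred (Fin n) 0ℓ
      Step R x = x ∈ R ⊎ P x ⊎ x ≡ ε
               ⊎ (∃₂ λ y z → y ∈ R × z ∈ R × x ≡ y ∙ z) ⊎ (∃ λ y → y ∈ R × x ≡ y ⁻¹)

      step? : ∀ R → Decidable (Step R)
      step? R x = x ∈? R ⊎-dec P? x ⊎-dec x ≟ᶠ ε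
        ⊎-dec any? (λ y → any? (λ z → y ∈? R ×-dec z ∈? R ×-dec x ≟ᶠ y ∙ z))
        ⊎-dec any? (λ y → y ∈? R ×-dec x ≟ᶠ y ⁻¹)

      approx : ℕ → Subset n
      approx zero = ⊥
      approx (suc m) = subsetOf (step? (approx m))

      approx-sound : ∀ m {x} → x ∈ approx m → Gen G P x
      approx-sound zero x∈ = contradiction x∈ ∉⊥
      approx-sound (suc m) x∈ with ∈-subsetOf⁻ (step? (approx m)) x∈
      ... | inj₁ x∈R = approx-sound m x∈R
      ... | inj₂ (inj₁ p) = gen-base p
      ... | inj₂ (inj₂ (inj₁ refl)) = gen-ε
      ... | inj₂ (inj₂ (inj₂ (inj₁ (_ , _ , y∈ , z∈ , refl)))) = gen-∙ (approx-sound m y∈) (approx-sound m z∈)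
      ... | inj₂ (inj₂ (inj₂ (inj₂ (_ , y∈ , refl)))) = gen-⁻¹ (approx-sound m y∈)

      Stable : ℕ → Set
      Stable m = approx (suc m) ⊆ approx m

      stable-or-large : ∀ m → ∃ Stable ⊎ m ≤ ∣ approx m ∣
      stable-or-large zero = inj₂ z≤n
      stable-or-large (suc m) with stable-or-large m
      ... | inj₁ stable = inj₁ stable
      ... | inj₂ m≤ with any? (λ x → x ∈? approx (suc m) ×-dec ¬? (x ∈? approx m))
      ...   | yes new = inj₂ (ℕ.≤-<-trans m≤ (p⊂q⇒∣p∣<∣q∣ (∈-subsetOf⁺ (step? (approx m)) ∘ inj₁ , new)))
      ...   | no ¬new = inj₁ (m , λ {x} x∈ → decidable-stable (x ∈? approx m) λ x∉ → ¬new (x , x∈ , x∉))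

      stabilises : ∃ Stable
      stabilises = fromInj₁ (λ large → contradiction (ℕ.≤-trans large (∣p∣≤n (approx (suc n)))) ℕ.1+n≰n) (stable-or-large (suc n))

      stable-complete : ∀ {m} → Stable m → ∀ {x} → Gen G P x → x ∈ approx m
      stable-complete {m} stable = Gen-least closed (λ p → step (inj₂ (inj₁ p)))
        where
        step : ∀ {x} → Step (approx m) x → x ∈ approx m
        step = stable ∘ ∈-subsetOf⁺ (step? (approx m))
        closed : IsSubgroup G (approx m)
        closed = step (inj₂ (inj₂ (inj₁ refl)))
               , (λ y∈ z∈ → step (inj₂ (inj₂ (inj₂ (inj₁ (_ , _ , y∈ , z∈ , refl))))))
               , (λ y∈ → step (inj₂ (inj₂ (inj₂ (inj₂ (_ , y∈ , refl))))))

    Gen? : Decidable (Gen G P)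
    Gen? x with stabilises
    ... | m , stable = map′ (approx-sound m) (stable-complete {m} stable) (x ∈? approx m)

  isTrivial? : ∀ A → Dec (IsTrivial G A)
  isTrivial? A = allᵢ? (λ x → x ∈? A →-dec x ≟ᶠ ε)

  isSubgroup? : ∀ A → Dec (IsSubgroup G A)
  isSubgroup? A = ε ∈? A
    ×-dec allᵢ? (λ x → allᵢ? (λ y → x ∈? A →-dec y ∈? A →-dec x ∙ y ∈? A))
    ×-dec allᵢ? (λ x → x ∈? A →-dec x ⁻¹ ∈? A)

  isNormalSubgroup? : ∀ A → Dec (IsNormalSubgroup G A)
  isNormalSubgroup? A = isSubgroup? A ×-dec all? (λ g → allᵢ? (λ x → x ∈? A →-dec conj G g x ∈? A))

  isMinimalNormal? : ∀ M → Dec (IsMinimalNormal G M)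
  isMinimalNormal? M = isNormalSubgroup? M ×-dec ¬? (isTrivial? M)
    ×-dec allSubsets? (λ K → isNormalSubgroup? K →-dec (K ⊆? M →-dec (isTrivial? K ⊎-dec M ⊆? K)))

  soc? : Decidable (InSoc G)
  soc? = Gen? (λ x → anySubset? (λ M → isMinimalNormal? M ×-dec x ∈? M))

  ncl? : ∀ S → Decidable (InNcl G S)
  ncl? S = Gen? (λ x → any? (λ g → any? (λ s → s ∈? S ×-dec x ≟ᶠ conj G g s)))

  soc-conjClosed : ConjClosed (InSoc G)
  soc-conjClosed = Gen-conjClosed λ { g (M , M-min , x∈M) → M , M-min , proj₂ (proj₁ M-min) g x∈M }

  normal⇒normalisedBy : ∀ {A B} → IsNormalSubgroup G A → NormalisedBy G A B
  normal⇒normalisedBy (_ , A-conj) _ = A-conj _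

  minimalNormal-∩ : ∀ {M K} → IsMinimalNormal G M → IsNormalSubgroup G K → IsTrivial G (M ∩ K) ⊎ M ⊆ K
  minimalNormal-∩ {M} {K} (M-normal , _ , M-minimal) K-normal =
    Sum.map₂ (λ M⊆M∩K x∈M → p∩q⊆q M K (M⊆M∩K x∈M))
      (M-minimal (M ∩ K) (∩-isNormalSubgroup M-normal K-normal) (p∩q⊆p M K))

  Centralising : Subset n → Pred (Fin n) 0ℓ
  Centralising A x = ∀ {y} → y ∈ A → Commute x y

  Centralises : Subset n → Subset n → Set
  Centralises A B = ∀ {x} → x ∈ A → Centralising B x

  Centreless : Subset n → Set
  Centreless A = ∀ {z} → z ∈ A → Centralising A z → z ≡ ε

  centralising? : ∀ A → Decidable (Centralising A)
  centralising? A x = allᵢ? (λ y → y ∈? A →-dec x ∙ y ≟ᶠ y ∙ x)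

  centralising-closed : ∀ {A} → SubgroupClosed (Centralising A)
  centralising-closed = (λ _ → commute-εˡ _) , (λ x↔ z↔ y∈ → commute-∙ˡ (x↔ y∈) (z↔ y∈)) , (λ x↔ y∈ → commute-⁻¹ˡ (x↔ y∈))

  centralising-conj : ∀ {A g x} → (∀ {y} → y ∈ A → conj G (g ⁻¹) y ∈ A) → Centralising A x → Centralising A (conj G g x)
  centralising-conj {A} {g} {x} g⁻¹-normalises x↔A {y} y∈A =
    subst (Commute (conj G g x)) (conj-inverseʳ g y) (commute-conj g (x↔A (g⁻¹-normalises y∈A)))

  centraliser : ∀ {H} → Decidable H → Subset n → Subset n
  centraliser H? A = subsetOf (λ x → H? x ×-dec centralising? A x)

  centraliser-isSubgroup : ∀ {H} (H? : Decidable H) {A} → SubgroupClosed H → IsSubgroup G (centraliser H? A)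
  centraliser-isSubgroup H? {A} H-sg = subsetOf-isSubgroup (λ x → H? x ×-dec centralising? A x) (×-subgroupClosed H-sg centralising-closed)

  trivial-∩⇒centralises : ∀ {A B} → IsSubgroup G A → IsSubgroup G B → NormalisedBy G A B → NormalisedBy G B A
    → IsTrivial G (A ∩ B) → Centralises A B
  trivial-∩⇒centralises {A} {B} (_ , A-∙ , A-⁻¹) (_ , B-∙ , B-⁻¹) B-normalises-A A-normalises-B A∩B≡1 {x} x∈A {y} y∈B =
    commutator≡ε⇒commute (A∩B≡1 (x∈p∩q⁺ (∈A , ∈B)))
    where
    ∈A : conj G x y ∙ y ⁻¹ ∈ A
    ∈A = subst (_∈ A) (sym (commutator-assoc x y)) (A-∙ x∈A (B-normalises-A y∈B (A-⁻¹ x∈A)))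
    ∈B : conj G x y ∙ y ⁻¹ ∈ B
    ∈B = B-∙ (A-normalises-B x∈A y∈B) (B-⁻¹ y∈B)

  simple-⊆ : ∀ {A B} → IsSimpleSubgroup G A → IsSubgroup G B → NormalisedBy G B A → ¬ IsTrivial G (A ∩ B) → A ⊆ B
  simple-⊆ {A} {B} (A-sg , _ , A-simple) B-sg A-normalises-B A∩B≢1 =
    [ (λ A∩B≡1 → contradiction A∩B≡1 A∩B≢1) , (λ (A⊆A∩B : A ⊆ A ∩ B) x∈A → p∩q⊆q A B (A⊆A∩B x∈A)) ]′
      (A-simple (A ∩ B) (∩-isSubgroup A-sg B-sg) (p∩q⊆p A B) A-normalises-A∩B)
    where
    A-normalises-A∩B : NormalisedBy G (A ∩ B) A
    A-normalises-A∩B a∈A x∈ = x∈p∩q⁺ (subgroupClosed-conj A-sg a∈A (p∩q⊆p A B x∈) , A-normalises-B a∈A (p∩q⊆q A B x∈))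

  simple-dichotomy : ∀ {A B} → IsSimpleSubgroup G A → IsSimpleSubgroup G B → NormalisedBy G A B → NormalisedBy G B A
    → Centralises A B ⊎ A ≡ B
  simple-dichotomy {A} {B} A-simple B-simple B-normalises-A A-normalises-B with isTrivial? (A ∩ B)
  ... | yes A∩B≡1 = inj₁ (trivial-∩⇒centralises (proj₁ A-simple) (proj₁ B-simple) B-normalises-A A-normalises-B A∩B≡1)
  ... | no A∩B≢1 = inj₂ (⊆-antisym (simple-⊆ A-simple (proj₁ B-simple) A-normalises-B A∩B≢1)
                                   (simple-⊆ B-simple (proj₁ A-simple) B-normalises-A (subst (¬_ ∘ IsTrivial G) (∩-comm A B) A∩B≢1)))

  simple-centreless : ∀ {A} → IsSimpleSubgroup G A → ¬ IsAbelianSet G A → Centreless A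
  simple-centreless {A} (A-sg , _ , A-simple) A-nonabelian z∈A z↔A =
    [ (λ (Z≡1 : IsTrivial G Z) → Z≡1 (∈-subsetOf⁺ Z? (z∈A , z↔A)))
    , (λ (A⊆Z : A ⊆ Z) → ⊥-elim (A-nonabelian (abelian A⊆Z))) ]′
      (A-simple Z (centraliser-isSubgroup (_∈? A) A-sg) (proj₁ ∘ ∈Z⁻) A-normalises-Z)
    where
    Z? = λ x → x ∈? A ×-dec centralising? A x
    Z = centraliser (_∈? A) A
    ∈Z⁻ : ∀ {x} → x ∈ Z → x ∈ A × Centralising A x
    ∈Z⁻ = ∈-subsetOf⁻ Z?
    A-normalises-Z : NormalisedBy G Z A
    A-normalises-Z u∈A x∈Z = subst (_∈ Z) (sym (commute⇒conj≡ (sym (proj₂ (∈Z⁻ x∈Z) u∈A)))) x∈Z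
    abelian : A ⊆ Z → IsAbelianSet G A
    abelian A⊆Z x∈A = proj₂ (∈Z⁻ (A⊆Z x∈A))

  centreless-factor-unique : ∀ {A} → IsSubgroup G A → Centreless A
    → ∀ {c d p q} → c ∈ A → d ∈ A → Centralising A p → Centralising A q → c ∙ p ≡ d ∙ q → c ≡ d
  centreless-factor-unique {A} (_ , A-∙ , A-⁻¹) A-centreless {c} {d} {p} {q} c∈A d∈A p↔A q↔A e = begin
    c               ≡⟨ sym (\\-leftDividesˡ d c) ⟩
    d ∙ (d ⁻¹ ∙ c)  ≡⟨ cong (d ∙_) (A-centreless (A-∙ (A-⁻¹ d∈A) c∈A) quotient-central) ⟩
    d ∙ ε           ≡⟨ identityʳ d ⟩
    d               ∎
    where
    quotient : d ⁻¹ ∙ c ≡ q ∙ p ⁻¹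
    quotient = begin
      d ⁻¹ ∙ c               ≡⟨ sym (//-rightDividesʳ p (d ⁻¹ ∙ c)) ⟩
      d ⁻¹ ∙ c ∙ p ∙ p ⁻¹    ≡⟨ cong (_∙ p ⁻¹) (assoc (d ⁻¹) c p) ⟩
      d ⁻¹ ∙ (c ∙ p) ∙ p ⁻¹  ≡⟨ cong (λ z → d ⁻¹ ∙ z ∙ p ⁻¹) e ⟩
      d ⁻¹ ∙ (d ∙ q) ∙ p ⁻¹  ≡⟨ cong (_∙ p ⁻¹) (\\-leftDividesʳ d q) ⟩
      q ∙ p ⁻¹               ∎
    quotient-central : Centralising A (d ⁻¹ ∙ c)
    quotient-central = subst (Centralising A) (sym quotient)
      (proj₁ (proj₂ centralising-closed) q↔A (proj₂ (proj₂ centralising-closed) p↔A))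

  InProduct : Subset n → Subset n → Pred (Fin n) 0ℓ
  InProduct A B x = ∃[ a ] ∃[ b ] (a ∈ A × b ∈ B × x ≡ a ∙ b)

  ∈A⇒InProduct : ∀ {A B x} → IsSubgroup G B → x ∈ A → InProduct A B x
  ∈A⇒InProduct {x = x} (B-ε , _) x∈A = x , ε , x∈A , B-ε , sym (identityʳ x)

  ∈B⇒InProduct : ∀ {A B x} → IsSubgroup G A → x ∈ B → InProduct A B x
  ∈B⇒InProduct {x = x} (A-ε , _) x∈B = ε , x , A-ε , x∈B , sym (identityˡ x)

  InProduct-closed : ∀ {A B} → IsSubgroup G A → IsSubgroup G B → Centralises B A → SubgroupClosed (InProduct A B)
  InProduct-closed (A-ε , A-∙ , A-⁻¹) (B-ε , B-∙ , B-⁻¹) B↔A =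
    (ε , ε , A-ε , B-ε , sym (identityˡ ε)) ,
    (λ { (a , b , a∈ , b∈ , refl) (a′ , b′ , a′∈ , b′∈ , refl) →
           a ∙ a′ , b ∙ b′ , A-∙ a∈ a′∈ , B-∙ b∈ b′∈ , commute⇒interchange a b a′ b′ (B↔A b∈ a′∈) }) ,
    (λ { (a , b , a∈ , b∈ , refl) →
           a ⁻¹ , b ⁻¹ , A-⁻¹ a∈ , B-⁻¹ b∈ , trans (⁻¹-anti-homo-∙ a b) (B↔A (B-⁻¹ b∈) (A-⁻¹ a∈)) })

  conjugate : Fin n → Subset n → Subset n
  conjugate g A = subsetOf (λ x → conj G (g ⁻¹) x ∈? A)

  ∈-conjugate⁺ : ∀ {g A x} → conj G (g ⁻¹) x ∈ A → x ∈ conjugate g A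
  ∈-conjugate⁺ {g} {A} = ∈-subsetOf⁺ (λ x → conj G (g ⁻¹) x ∈? A)

  ∈-conjugate⁻ : ∀ {g A x} → x ∈ conjugate g A → conj G (g ⁻¹) x ∈ A
  ∈-conjugate⁻ {g} {A} = ∈-subsetOf⁻ (λ x → conj G (g ⁻¹) x ∈? A)

  conj∈conjugate : ∀ {A} g {a} → a ∈ A → conj G g a ∈ conjugate g A
  conj∈conjugate {A} g {a} a∈A = ∈-conjugate⁺ (subst (_∈ A) (sym (conj-inverseˡ g a)) a∈A)

  conjugate-isSubgroup : ∀ {A} g → IsSubgroup G A → IsSubgroup G (conjugate g A)
  conjugate-isSubgroup {A} g A-sg = subsetOf-isSubgroup (λ x → conj G (g ⁻¹) x ∈? A) (conj-preimage-closed (g ⁻¹) A-sg)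

  conjugate-isSimpleSubgroup : ∀ {A} g → IsSimpleSubgroup G A → IsSimpleSubgroup G (conjugate g A)
  conjugate-isSimpleSubgroup {A} g (A-sg , A≢1 , A-simple) = conjugate-isSubgroup g A-sg , gAg⁻¹≢1 , gAg⁻¹-simple
    where
    gAg⁻¹≢1 : ¬ IsTrivial G (conjugate g A)
    gAg⁻¹≢1 gAg⁻¹≡1 = A≢1 λ a∈A → conj-injective g (trans (gAg⁻¹≡1 (conj∈conjugate g a∈A)) (sym (conj-ε g)))

    gAg⁻¹-simple : ∀ K → IsSubgroup G K → K ⊆ conjugate g A → NormalisedBy G K (conjugate g A)
      → IsTrivial G K ⊎ conjugate g A ⊆ K
    gAg⁻¹-simple K K-sg K⊆gAg⁻¹ gAg⁻¹-normalises-K =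
      Sum.map K-trivial gAg⁻¹⊆K (A-simple K′ K′-sg K′⊆A A-normalises-K′)
      where
      K′? = λ x → conj G g x ∈? K
      K′ = subsetOf K′?
      K′-sg : IsSubgroup G K′
      K′-sg = subsetOf-isSubgroup K′? (conj-preimage-closed g K-sg)
      K′⊆A : K′ ⊆ A
      K′⊆A {x} x∈K′ = subst (_∈ A) (conj-inverseˡ g x) (∈-conjugate⁻ (K⊆gAg⁻¹ (∈-subsetOf⁻ K′? x∈K′)))
      A-normalises-K′ : NormalisedBy G K′ A
      A-normalises-K′ {u} {x} u∈A x∈K′ = ∈-subsetOf⁺ K′? (subst (_∈ K) (sym (conj-distrib-conj g u x))
        (gAg⁻¹-normalises-K (conj∈conjugate g u∈A) (∈-subsetOf⁻ K′? x∈K′)))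
      g⁻¹yg∈K′ : ∀ {y} → y ∈ K → conj G (g ⁻¹) y ∈ K′
      g⁻¹yg∈K′ {y} y∈K = ∈-subsetOf⁺ K′? (subst (_∈ K) (sym (conj-inverseʳ g y)) y∈K)
      K-trivial : IsTrivial G K′ → IsTrivial G K
      K-trivial K′≡1 {y} y∈K = begin
        y                            ≡⟨ sym (conj-inverseʳ g y) ⟩
        conj G g (conj G (g ⁻¹) y)   ≡⟨ cong (conj G g) (K′≡1 (g⁻¹yg∈K′ y∈K)) ⟩
        conj G g ε                   ≡⟨ conj-ε g ⟩
        ε                            ∎
      gAg⁻¹⊆K : A ⊆ K′ → conjugate g A ⊆ K
      gAg⁻¹⊆K A⊆K′ {y} y∈gAg⁻¹ = subst (_∈ K) (conj-inverseʳ g y) (∈-subsetOf⁻ K′? (A⊆K′ (∈-conjugate⁻ y∈gAg⁻¹)))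

  conjugate-nonabelian : ∀ {A} g → ¬ IsAbelianSet G A → ¬ IsAbelianSet G (conjugate g A)
  conjugate-nonabelian g A-nonabelian gAg⁻¹-abelian = A-nonabelian λ {x} {y} x∈A y∈A → conj-injective g (begin
    conj G g (x ∙ y)            ≡⟨ conj-∙ g x y ⟩
    conj G g x ∙ conj G g y     ≡⟨ gAg⁻¹-abelian (conj∈conjugate g x∈A) (conj∈conjugate g y∈A) ⟩
    conj G g y ∙ conj G g x     ≡⟨ sym (conj-∙ g y x) ⟩
    conj G g (y ∙ x)            ∎)

  NormalInNcl : Subset n → Set
  NormalInNcl S = ∀ {g x} → InNcl G S g → x ∈ S → conj G g x ∈ S

  module _ {S : Subset n} where

    ncl-conjClosed : ConjClosed (InNcl G S)
    ncl-conjClosed = Gen-conjClosed λ { g (h , s , s∈S , refl) → g ∙ h , s , s∈S , conj-conj g h s }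

    ⊆-ncl : ∀ {x} → x ∈ S → InNcl G S x
    ⊆-ncl {x} x∈S = gen-base (ε , x , x∈S , sym (conj-identity x))

    conjugate⊆ncl : ∀ g {x} → x ∈ conjugate g S → InNcl G S x
    conjugate⊆ncl g {x} x∈gSg⁻¹ = gen-base (g , conj G (g ⁻¹) x , ∈-conjugate⁻ x∈gSg⁻¹ , sym (conj-inverseʳ g x))

    ncl-least : ∀ {Q} → SubgroupClosed Q → ConjClosed Q → (∀ {x} → x ∈ S → Q x) → ∀ {x} → InNcl G S x → Q x
    ncl-least Q-sg Q-conj S⊆Q = Gen-least Q-sg λ { (g , s , s∈S , refl) → Q-conj g (S⊆Q s∈S) }

    ncl-centralised : ∀ {K} → ConjClosed (_∈ K) → Centralises S K → ∀ {y} → InNcl G S y → Centralising K y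
    ncl-centralised K-conj S↔K = Gen-least centralising-closed λ { (g , s , s∈S , refl) {x} x∈K →
      subst (Commute (conj G g s)) (conj-inverseʳ g x) (commute-conj g (S↔K s∈S (K-conj (g ⁻¹) x∈K))) }

    ncl-normalises-conjugate : NormalInNcl S → ∀ g {h x} → InNcl G S h → x ∈ conjugate g S → conj G h x ∈ conjugate g S
    ncl-normalises-conjugate S◁N g {h} {x} h∈N x∈gSg⁻¹ = ∈-conjugate⁺
      (subst (_∈ S) (sym (conj-distrib-conj (g ⁻¹) h x)) (S◁N (ncl-conjClosed (g ⁻¹) h∈N) (∈-conjugate⁻ x∈gSg⁻¹)))

  -- Multiplying elements of pairwise commuting conjugates of S

  module _ {S : Subset n} (S-simple : IsSimpleSubgroup G S) (S-nonabelian : ¬ IsAbelianSet G S) where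
    private
      S-sg : IsSubgroup G S
      S-sg = proj₁ S-simple

    ConjugatesCommute : Fin n → Fin n → Set
    ConjugatesCommute g h = Centralises (conjugate g S) (conjugate h S)

    product : (R : List (Fin n)) → (Fin (length R) → Fin n) → Fin n
    product [] a = ε
    product (g ∷ R) a = conj G g (head a) ∙ product R (tail a)

    product-cong : ∀ R {a b} → (∀ i → a i ≡ b i) → product R a ≡ product R b
    product-cong [] _ = refl
    product-cong (g ∷ R) a≡b = cong₂ _∙_ (cong (conj G g) (a≡b Fin.zero)) (product-cong R (a≡b ∘ Fin.suc))

    product-ε : ∀ R → product R (λ _ → ε) ≡ ε
    product-ε [] = refl
    product-ε (g ∷ R) = trans (cong₂ _∙_ (conj-ε g) (product-ε R)) (identityˡ ε)

    product-∈-ncl : ∀ R {a} → InPow G (length R) S a → InNcl G S (product R a)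
    product-∈-ncl [] _ = gen-ε
    product-∈-ncl (g ∷ R) a∈S = gen-∙ (gen-base (g , _ , a∈S Fin.zero , refl)) (product-∈-ncl R (a∈S ∘ Fin.suc))

    product-centralising : ∀ {g} R → All (ConjugatesCommute g) R → ∀ {a} → InPow G (length R) S a
      → Centralising (conjugate g S) (product R a)
    product-centralising [] [] _ _ = commute-εˡ _
    product-centralising (r ∷ R) (g↔r ∷ g↔R) a∈S y∈gSg⁻¹ =
      commute-∙ˡ (sym (g↔r y∈gSg⁻¹ (conj∈conjugate r (a∈S Fin.zero)))) (product-centralising R g↔R (a∈S ∘ Fin.suc) y∈gSg⁻¹)

    product-∙ : ∀ R → AllPairs ConjugatesCommute R → ∀ {a b} → InPow G (length R) S a → InPow G (length R) S b
      → product R (λ i → a i ∙ b i) ≡ product R a ∙ product R b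
    product-∙ [] _ _ _ = sym (identityˡ ε)
    product-∙ (g ∷ R) (g↔R ∷ R↔R) {a} {b} a∈S b∈S = begin
      conj G g (head a ∙ head b) ∙ product R (λ i → tail a i ∙ tail b i)
        ≡⟨ cong₂ _∙_ (conj-∙ g (head a) (head b)) (product-∙ R R↔R (a∈S ∘ Fin.suc) (b∈S ∘ Fin.suc)) ⟩
      (conj G g (head a) ∙ conj G g (head b)) ∙ (product R (tail a) ∙ product R (tail b))
        ≡⟨ commute⇒interchange _ _ _ _ (sym (product-centralising R g↔R (a∈S ∘ Fin.suc) (conj∈conjugate g (b∈S Fin.zero)))) ⟩
      (conj G g (head a) ∙ product R (tail a)) ∙ (conj G g (head b) ∙ product R (tail b)) ∎

    product-⁻¹ : ∀ R → AllPairs ConjugatesCommute R → ∀ {a} → InPow G (length R) S a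
      → product R (λ i → a i ⁻¹) ≡ product R a ⁻¹
    product-⁻¹ R R↔R {a} a∈S = inverseʳ-unique _ _ (begin
      product R a ∙ product R (λ i → a i ⁻¹)  ≡⟨ sym (product-∙ R R↔R a∈S (λ i → proj₂ (proj₂ S-sg) (a∈S i))) ⟩
      product R (λ i → a i ∙ a i ⁻¹)           ≡⟨ product-cong R (inverseʳ ∘ a) ⟩
      product R (λ _ → ε)                      ≡⟨ product-ε R ⟩
      ε                                        ∎)

    product-injective : ∀ R → AllPairs ConjugatesCommute R → ∀ {a b} → InPow G (length R) S a → InPow G (length R) S b
      → product R a ≡ product R b → ∀ i → a i ≡ b i
    product-injective (g ∷ R) (g↔R ∷ R↔R) {a} {b} a∈S b∈S e = λ where
        Fin.zero → conj-injective g heads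
        (Fin.suc i) → product-injective R R↔R (a∈S ∘ Fin.suc) (b∈S ∘ Fin.suc) tails i
      where
      heads : conj G g (head a) ≡ conj G g (head b)
      heads = centreless-factor-unique (conjugate-isSubgroup g S-sg)
        (simple-centreless (conjugate-isSimpleSubgroup g S-simple) (conjugate-nonabelian g S-nonabelian))
        (conj∈conjugate g (a∈S Fin.zero)) (conj∈conjugate g (b∈S Fin.zero))
        (product-centralising R g↔R (a∈S ∘ Fin.suc)) (product-centralising R g↔R (b∈S ∘ Fin.suc)) e
      tails : product R (tail a) ≡ product R (tail b)
      tails = ∙-cancelˡ (conj G g (head a)) _ _ (trans e (cong (_∙ product R (tail b)) (sym heads)))

    Image : List (Fin n) → Pred (Fin n) 0ℓ
    Image R x = ∃[ a ] (InPow G (length R) S a × product R a ≡ x)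

    image-conjugate : ∀ R {x} → Any (λ r → x ∈ conjugate r S) R → Image R x
    image-conjugate (g ∷ R) {x} (here x∈gSg⁻¹) =
      conj G (g ⁻¹) x Vector.∷ (λ _ → ε) ,
      (λ where Fin.zero → ∈-conjugate⁻ x∈gSg⁻¹
               (Fin.suc _) → proj₁ S-sg) ,
      trans (cong₂ _∙_ (conj-inverseʳ g x) (product-ε R)) (identityʳ x)
    image-conjugate (g ∷ R) (there x∈R) with image-conjugate R x∈R
    ... | a , a∈S , refl =
      ε Vector.∷ a ,
      (λ where Fin.zero → proj₁ S-sg
               (Fin.suc i) → a∈S i) ,
      trans (cong (_∙ product R a) (conj-ε g)) (identityˡ _)

    image-closed : ∀ R → AllPairs ConjugatesCommute R → SubgroupClosed (Image R)
    image-closed R R↔R =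
      ((λ _ → ε) , (λ _ → proj₁ S-sg) , product-ε R) ,
      (λ { (a , a∈S , refl) (b , b∈S , refl) →
             (λ i → a i ∙ b i) , (λ i → proj₁ (proj₂ S-sg) (a∈S i) (b∈S i)) , product-∙ R R↔R a∈S b∈S }) ,
      (λ { (a , a∈S , refl) → (λ i → a i ⁻¹) , (λ i → proj₂ (proj₂ S-sg) (a∈S i)) , product-⁻¹ R R↔R a∈S })

    product-isoToPow : ∀ R → AllPairs ConjugatesCommute R → (∀ g {x} → x ∈ conjugate g S → Any (λ r → x ∈ conjugate r S) R)
      → IsoToPow G (InNcl G S) S (length R)
    product-isoToPow R R↔R covers =
      product R ,
      (λ _ → product-∈-ncl R) ,
      (λ _ _ → product-∙ R R↔R) ,
      (λ _ _ → product-injective R R↔R) ,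
      (λ _ → Gen-least (image-closed R R↔R) λ { (g , s , s∈S , refl) → image-conjugate R (covers g (conj∈conjugate g s∈S)) })

    conjugates-commute : NormalInNcl S → ∀ {g h} → conjugate g S ≢ conjugate h S → ConjugatesCommute g h
    conjugates-commute S◁N {g} {h} gSg⁻¹≢hSh⁻¹ = fromInj₁ (λ gSg⁻¹≡hSh⁻¹ → contradiction gSg⁻¹≡hSh⁻¹ gSg⁻¹≢hSh⁻¹)
      (simple-dichotomy (conjugate-isSimpleSubgroup g S-simple) (conjugate-isSimpleSubgroup h S-simple)
        (ncl-normalises-conjugate S◁N g ∘ conjugate⊆ncl h) (ncl-normalises-conjugate S◁N h ∘ conjugate⊆ncl g))

    ncl-isoToPow : NormalInNcl S → ∃[ k ] (1 ≤ k × IsoToPow G (InNcl G S) S k)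
    ncl-isoToPow S◁N =
      length representatives , nonempty (covers ε (conj∈conjugate ε (proj₁ S-sg))) ,
      product-isoToPow representatives (AllPairs.map (conjugates-commute S◁N) distinct) covers
      where
      conjugate-≟ : ∀ g h → Dec (conjugate g S ≡ conjugate h S)
      conjugate-≟ g h = ≡-dec Bool._≟_ (conjugate g S) (conjugate h S)
      representatives : List (Fin n)
      representatives = deduplicate conjugate-≟ (allFin n)
      distinct : AllPairs (λ g h → conjugate g S ≢ conjugate h S) representatives
      distinct = deduplicate-! (On.decSetoid (decSetoid (≡-dec Bool._≟_)) (λ g → conjugate g S)) (allFin n)
      covers : ∀ g {x} → x ∈ conjugate g S → Any (λ r → x ∈ conjugate r S) representatives
      covers g {x} x∈gSg⁻¹ = deduplicate⁺ conjugate-≟ (λ e → subst (x ∈_) (sym e))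
        (Any.map (λ g≡r → subst (λ r → x ∈ conjugate r S) g≡r x∈gSg⁻¹) (∈-allFin g))
      nonempty : ∀ {P : Pred (Fin n) 0ℓ} {xs} → Any P xs → 1 ≤ length xs
      nonempty (here _) = s≤s z≤n
      nonempty (there _) = s≤s z≤n

  -- The socle splits off S

  module _ (G-semisimple : Semisimple G) {S : Subset n} (S-simple : IsSimpleSubgroup G S) (S-nonabelian : ¬ IsAbelianSet G S)
           (S◁N : NormalInNcl S) where
    private
      S-sg : IsSubgroup G S
      S-sg = proj₁ S-simple
      N : Subset n
      N = subsetOf (ncl? S)
      ∈N⁺ : ∀ {x} → InNcl G S x → x ∈ N
      ∈N⁺ = ∈-subsetOf⁺ (ncl? S)
      ∈N⁻ : ∀ {x} → x ∈ N → InNcl G S x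
      ∈N⁻ = ∈-subsetOf⁻ (ncl? S)

    ncl-isNormalSubgroup : IsNormalSubgroup G N
    ncl-isNormalSubgroup = subsetOf-isSubgroup (ncl? S) Gen-closed , λ g x∈N → ∈N⁺ (ncl-conjClosed g (∈N⁻ x∈N))

    ncl-isMinimalNormal : IsMinimalNormal G N
    ncl-isMinimalNormal = ncl-isNormalSubgroup , (λ N≡1 → proj₁ (proj₂ S-simple) (N≡1 ∘ ∈N⁺ ∘ ⊆-ncl)) , N-minimal
      where
      N-minimal : ∀ K → IsNormalSubgroup G K → K ⊆ N → IsTrivial G K ⊎ N ⊆ K
      N-minimal K (K-sg , K-conj) K⊆N with isTrivial? (S ∩ K)
      ... | no S∩K≢1 = inj₂ (ncl-least K-sg K-conj (simple-⊆ S-simple K-sg (λ _ → K-conj _) S∩K≢1) ∘ ∈N⁻)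
      ... | yes S∩K≡1 = inj₁ (G-semisimple K (K-sg , K-conj) K-abelian)
        where
        S↔K : Centralises S K
        S↔K = trivial-∩⇒centralises S-sg K-sg (λ k∈K → S◁N (∈N⁻ (K⊆N k∈K))) (λ _ → K-conj _) S∩K≡1
        K-abelian : IsAbelianSet G K
        K-abelian x∈K y∈K = sym (ncl-centralised K-conj S↔K (∈N⁻ (K⊆N y∈K)) x∈K)

    ncl⊆soc : ∀ {x} → InNcl G S x → InSoc G x
    ncl⊆soc x∈N = gen-base (N , ncl-isMinimalNormal , ∈N⁺ x∈N)

    private
      T? : Decidable (λ x → InSoc G x × Centralising S x)
      T? x = soc? x ×-dec centralising? S x
      T : Subset n
      T = centraliser soc? S
      ∈T⁻ : ∀ {x} → x ∈ T → InSoc G x × Centralising S x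
      ∈T⁻ = ∈-subsetOf⁻ T?
      T-sg : IsSubgroup G T
      T-sg = centraliser-isSubgroup soc? {S} Gen-closed
      ST-closed : SubgroupClosed (InProduct S T)
      ST-closed = InProduct-closed S-sg T-sg (proj₂ ∘ ∈T⁻)

    ncl⊆ST : ∀ {x} → InNcl G S x → InProduct S T x
    ncl⊆ST = Gen-least ST-closed λ { (g , s , s∈S , refl) → conjugate⊆ST g (conj∈conjugate g s∈S) }
      where
      conjugate⊆ST : ∀ g {x} → x ∈ conjugate g S → InProduct S T x
      conjugate⊆ST g x∈gSg⁻¹ =
        [ (λ gSg⁻¹↔S → ∈B⇒InProduct S-sg (∈-subsetOf⁺ T? (ncl⊆soc (conjugate⊆ncl g x∈gSg⁻¹) , gSg⁻¹↔S x∈gSg⁻¹))) ,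
          (λ gSg⁻¹≡S → ∈A⇒InProduct T-sg (subst (_ ∈_) gSg⁻¹≡S x∈gSg⁻¹)) ]′
        (simple-dichotomy (conjugate-isSimpleSubgroup g S-simple) S-simple
          (ncl-normalises-conjugate S◁N g ∘ ⊆-ncl) (S◁N ∘ conjugate⊆ncl g))

    soc⊆ST : ∀ {x} → InSoc G x → InProduct S T x
    soc⊆ST = Gen-least ST-closed λ { (M , M-min , x∈M) → minimalNormal⊆ST M-min x∈M }
      where
      minimalNormal⊆ST : ∀ {M x} → IsMinimalNormal G M → x ∈ M → InProduct S T x
      minimalNormal⊆ST {M} {x} M-min@(M-normal , _) x∈M =
        [ (λ (M∩N≡1 : IsTrivial G (M ∩ N)) → ∈B⇒InProduct S-sg (∈-subsetOf⁺ T? (gen-base (M , M-min , x∈M) , x↔S M∩N≡1)))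
        , (λ (M⊆N : M ⊆ N) → ncl⊆ST (∈N⁻ (M⊆N x∈M))) ]′
          (minimalNormal-∩ M-min ncl-isNormalSubgroup)
        where
        x↔S : IsTrivial G (M ∩ N) → Centralising S x
        x↔S M∩N≡1 y∈S = trivial-∩⇒centralises (proj₁ M-normal) (proj₁ ncl-isNormalSubgroup)
          (normal⇒normalisedBy M-normal) (normal⇒normalisedBy ncl-isNormalSubgroup) M∩N≡1 x∈M (∈N⁺ (⊆-ncl y∈S))

    ST-normalises-S : ∀ {g x} → InProduct S T g → x ∈ S → conj G g x ∈ S
    ST-normalises-S {x = x} (s , t , s∈S , t∈T , refl) x∈S = subst (_∈ S) (begin
      conj G s x             ≡⟨ cong (conj G s) (sym (commute⇒conj≡ (proj₂ (∈T⁻ t∈T) x∈S))) ⟩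
      conj G s (conj G t x)  ≡⟨ conj-conj s t x ⟩
      conj G (s ∙ t) x       ∎) (subgroupClosed-conj S-sg s∈S x∈S)

    soc-normalises-S : ∀ {g x} → InSoc G g → x ∈ S → conj G g x ∈ S
    soc-normalises-S = ST-normalises-S ∘ soc⊆ST

    soc-normalises-T : ∀ {g x} → InSoc G g → x ∈ T → conj G g x ∈ T
    soc-normalises-T g∈Soc x∈T = ∈-subsetOf⁺ T?
      ( subgroupClosed-conj Gen-closed g∈Soc (proj₁ (∈T⁻ x∈T))
      , centralising-conj (soc-normalises-S (gen-⁻¹ g∈Soc)) (proj₂ (∈T⁻ x∈T)) )

    isDirectFactorOfSoc : IsDirectFactorOfSoc G S
    isDirectFactorOfSoc =
      T , T-sg , ncl⊆soc ∘ ⊆-ncl , proj₁ ∘ ∈T⁻ , soc-normalises-S , soc-normalises-T ,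
      (λ x∈S x∈T → simple-centreless S-simple S-nonabelian x∈S (proj₂ (∈T⁻ x∈T))) , soc⊆ST

  directFactor⇒normalInNcl : ∀ {S} → IsDirectFactorOfSoc G S → NormalInNcl S
  directFactor⇒normalInNcl (_ , _ , S⊆Soc , _ , Soc-normalises-S , _) g∈N =
    Soc-normalises-S (ncl-least Gen-closed soc-conjClosed S⊆Soc g∈N)

mainTheorem7 : (G : FinGroup) → Semisimple G → (S : Subset (FinGroup.n G))
    → IsSimpleSubgroup G S → ¬ IsAbelianSet G S
    → IsDirectFactorOfSoc G S
      ⇔ ((∃[ k ] (1 ≤ k × IsoToPow G (InNcl G S) S k))
         × (∀ {x} → x ∈ S → InNcl G S x)
         × (∀ {g x} → InNcl G S g → x ∈ S → conj G g x ∈ S))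
mainTheorem7 G G-semisimple S S-simple S-nonabelian = mk⇔
  (λ S-factor → ncl-isoToPow G S-simple S-nonabelian (S◁N S-factor)
               , (λ {x} → ⊆-ncl G {S} {x}) , (λ {g} {x} → S◁N S-factor {g} {x}))
  (λ (_ , _ , S◁N) → isDirectFactorOfSoc G G-semisimple S-simple S-nonabelian S◁N)
  where
  S◁N : IsDirectFactorOfSoc G S → NormalInNcl G S
  S◁N = directFactor⇒normalInNcl G
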